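{- Let $n,k,\ell$ be integers with $0<k<n$ and $1<\ell$, and let $x^0\in\mathbb{Z}^n$ with $x^0_1\le\dots\le x^0_n$. Let $(x^j)_{j\ge 0}$ be the GM-$(n,k,\ell)$-sequence starting at $x^0$, and let $N=N(n,k,\ell,x^0)\ge 0$ be the integer such that, for all $j\ge 0$, both $m(x^j)\ge n-k$ and $\mathrm{range}(x^j)\le \ell$ hold if and only if $j\ge N$. Put $p=\ell n/\gcd(n,k)=\ell\,\mathrm{lcm}(n,k)/k$ and $\delta=pk/n$. Then for every $i\in[n]$ and every $j\ge N$ we have $x_i^{j}-x_i^{j+p}=\delta$, i.e. after every $p$ consecutive steps all entries are reduced by the same value $\delta$.
   Context: Notation: $[n]=\{1,\dots,n\}$. For an integer vector $x=(x_1,\dots,x_n)$ with $x_1\le\dots\le x_n$, let $M(x)$ be the set of indices $i\in[n]$ such that $x_i$ is a multiple of $\ell$, $m(x)=|M(x)|$, and $\mathrm{range}(x)=x_n-x_1$. The set $P(x)$ of bears (always of size $n-k$) is defined as follows. If $m(x)\ge n-k$: order the indices in $M(x)$ by increasing value $x_i$, and among indices with equal values by decreasing index $i$ (tie-breaking rule: prefer the rightmost), and let $P(x)$ be the first $n-k$ of them. If $m(x)<n-k$: $P(x)$ consists of all of $M(x)$ together with the $n-k-m(x)$ indices of $[n]\setminus M(x)$ with largest index (i.e. the largest entries). The remaining $k$ indices are bulls. The GM-$(n,k,\ell)$-move $x\to x'$ is given by $x'_i=x_i$ for $i\in P(x)$ and $x'_i=x_i-1$ for the $k$ bulls; it preserves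 the nondecreasing order of entries. The GM-$(n,k,\ell)$-sequence from $x^0$ is $x^0\to x^1\to x^2\to\cdots$ where $x^{j+1}$ is the GM-move of $x^j$. The existence of $N$ as described (with both conditions holding exactly for $j\ge N$) is part of the setting of the paper. -}

module Defs where

open import Data.Nat as ℕ using (ℕ; zero; suc; _∸_; _<ᵇ_)
open import Data.Nat.Divisibility as ℕD using ()
open import Data.Nat.GCD using (gcd)
open import Data.Nat.DivMod using (_/_)
open import Data.Integer as ℤ using (ℤ; ∣_∣)
open import Data.Integer.Divisibility as ℤD using ()
import Data.Integer.Properties as ℤP
open import Data.Fin as Fin using (Fin; fromℕ)
import Data.Fin.Properties as FinP
open import Data.Bool using (Bool; true; false; if_then_else_; _∧_; _∨_; not)
open import Relation.Nullary.Decidable using (⌊_⌋)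
open import Function using (_∘_)

countF : ∀ {n} → (Fin n → Bool) → ℕ
countF {zero}  f = 0
countF {suc n} f = (if f Fin.zero then 1 else 0) ℕ.+ countF (f ∘ Fin.suc)

isMult : ℕ → ℤ → Bool
isMult ℓ z = ⌊ ℓ ℕD.∣? ∣ z ∣ ⌋

inM : ∀ {n} → ℕ → (Fin n → ℤ) → Fin n → Bool
inM ℓ x i = isMult ℓ (x i)

m : ∀ {n} → ℕ → (Fin n → ℤ) → ℕ
m ℓ x = countF (inM ℓ x)

-- j precedes i in the order on M(x): increasing value, ties broken by decreasing index
precedes : ∀ {n} → (Fin n → ℤ) → Fin n → Fin n → Bool
precedes x j i = ⌊ x j ℤP.<? x i ⌋ ∨ (⌊ x j ℤ.≟ x i ⌋ ∧ ⌊ i FinP.<? j ⌋)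

isBear : ∀ {n} → ℕ → ℕ → (Fin n → ℤ) → Fin n → Bool
isBear {n} k ℓ x i with (n ∸ k) ℕ.≤ᵇ m ℓ x
... | true  = -- first n-k elements of M(x) in the above order
  inM ℓ x i ∧ (countF (λ j → inM ℓ x j ∧ precedes x j i) <ᵇ (n ∸ k))
... | false = -- all of M(x), plus the (n-k-m(x)) largest indices outside M(x)
  inM ℓ x i ∨ (countF (λ j → not (inM ℓ x j) ∧ ⌊ i FinP.<? j ⌋) <ᵇ ((n ∸ k) ∸ m ℓ x))

gmMove : ∀ {n} → ℕ → ℕ → (Fin n → ℤ) → (Fin n → ℤ)
gmMove k ℓ x i = if isBear k ℓ x i then x i else x i ℤ.- ℤ.1ℤ

gmSeq : ∀ {n} → ℕ → ℕ → (Fin n → ℤ) → ℕ → (Fin n → ℤ)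
gmSeq k ℓ x zero    = x
gmSeq k ℓ x (suc j) = gmMove k ℓ (gmSeq k ℓ x j)

-- range(x) = x_n - x_1 (0 for the empty vector, which never occurs since n > k > 0)
range : ∀ {n} → (Fin n → ℤ) → ℤ
range {zero}  x = ℤ.0ℤ
range {suc n} x = x (fromℕ n) ℤ.- x Fin.zero

Sorted : ∀ {n} → (Fin n → ℤ) → Set
Sorted x = ∀ i j → i Fin.≤ j → x i ℤ.≤ x j

-- p = ℓ n / gcd(n,k)  (gcd(n,k) ≠ 0 since n > 0; the zero case is a dummy)
period : ℕ → ℕ → ℕ → ℕ
period n k ℓ with gcd n k
... | zero  = 0
... | suc g = (ℓ ℕ.* n) / suc g

-- δ = p k / n  (n > 0; the zero case is a dummy)
shift : ℕ → ℕ → ℕ → ℕ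
shift zero    k ℓ = 0
shift (suc n) k ℓ = (period (suc n) k ℓ ℕ.* k) / suc n

-- Once the sequence is stable, a state x is best seen through its extension
-- ext x p = x (p mod n) + ℓ ⌊p / n⌋, which is nondecreasing because x is sorted with range
-- at most ℓ. In that picture a position is a bear iff it holds a multiple of ℓ and the extension
-- rises within the next n - k positions, and every k + 1 consecutive positions contain a multiple
-- (otherwise more than k entries would lie outside M). Following one position u against u - k for
-- ℓ steps then shows that ext (x^(t+ℓ)) u = ext (x^t) (u - k): ℓ steps rotate the extension by
-- k places. With g = gcd n k, doing this n / g times shifts by (k / g) n places, i.e. lowers every
-- entry by ℓ k / g = δ after p = ℓ n / g steps.

module Submission where

open import Defs
open import Data.Nat as ℕ using (ℕ; zero; suc; _+_; _*_; _∸_; _≤_; _<_; _<ᵇ_; z≤n; s≤s; _≤?_; _<?_)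
import Data.Nat.Properties as ℕP
import Data.Nat.Divisibility as ℕ∣
open import Data.Integer as ℤ using (ℤ; +_; ∣_∣; 1ℤ)
import Data.Integer.Properties as ℤP
open import Data.Integer.Divisibility.Signed as ℤ∣ using (_∣_)
open import Data.Integer.Tactic.RingSolver using (solve-∀)
open import Data.Nat.DivMod using (_%_; _/_; m%n<n; m<n⇒m%n≡m; m<n⇒m/n≡0; [m+n]%n≡m%n; m/n≡1+[m∸n]/n; m≡m%n+[m/n]*n; *-/-assoc; m*n/n≡m; m/n*n≡m)
open import Data.Nat.GCD using (gcd; gcd[m,n]∣m; gcd[m,n]∣n)
import Data.Nat.Tactic.RingSolver as ℕ-Ring
open import Data.Fin as Fin using (Fin; toℕ)
import Data.Fin.Properties as FinP
open import Data.Bool using (Bool; true; false; _∧_; _∨_; not; if_then_else_; _≟_)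
open import Data.Bool.Properties using (∨-zeroʳ; T-≡)
open import Data.Empty using (⊥-elim)
open import Data.Product using (Σ; _×_; _,_; proj₁; proj₂)
open import Data.Sum using (_⊎_; inj₁; inj₂)
open import Relation.Nullary using (Dec; yes; no; ¬_)
open import Relation.Nullary.Decidable using (⌊_⌋; isYes≗does; dec-true; dec-false; does-⇔)
open import Relation.Binary.PropositionalEquality
open import Relation.Binary.Definitions using (tri<; tri≈; tri>)
open import Function using (_∘_)
open import Function.Bundles using (_⇔_; mk⇔; Equivalence)

module _ {a} {A : Set a} (A? : Dec A) where

  ⌊⌋-true : A → ⌊ A? ⌋ ≡ true
  ⌊⌋-true x = trans (isYes≗does A?) (dec-true A? x)

  ⌊⌋-false : ¬ A → ⌊ A? ⌋ ≡ false
  ⌊⌋-false ¬x = trans (isYes≗does A?) (dec-false A? ¬x)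

⌊⌋-⇔ : ∀ {a b} {A : Set a} {B : Set b} → A ⇔ B → (A? : Dec A) (B? : Dec B) → ⌊ A? ⌋ ≡ ⌊ B? ⌋
⌊⌋-⇔ A⇔B A? B? = trans (isYes≗does A?) (trans (does-⇔ A⇔B A? B?) (sym (isYes≗does B?)))

⌊⌋-true⁻¹ : ∀ {a} {A : Set a} (A? : Dec A) → ⌊ A? ⌋ ≡ true → A
⌊⌋-true⁻¹ (yes x) _ = x

∧-true⁻¹ˡ : ∀ {a b} → a ∧ b ≡ true → a ≡ true
∧-true⁻¹ˡ {true} _ = refl

∧-true⁻¹ʳ : ∀ {a b} → a ∧ b ≡ true → b ≡ true
∧-true⁻¹ʳ {true} eq = eq

∧-true : ∀ {a b} → a ≡ true → b ≡ true → a ∧ b ≡ true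
∧-true refl refl = refl

∧-false : ∀ {a b} → a ≡ false → a ∧ b ≡ false
∧-false refl = refl

≢true⇒≡false : ∀ {b} → ¬ b ≡ true → b ≡ false
≢true⇒≡false {false} _ = refl
≢true⇒≡false {true}  ¬t = ⊥-elim (¬t refl)

∨-trueˡ : ∀ {a b} → a ≡ true → a ∨ b ≡ true
∨-trueˡ refl = refl

∨-trueʳ : ∀ {a b} → b ≡ true → a ∨ b ≡ true
∨-trueʳ {a} refl = ∨-zeroʳ a

∨-true⁻¹ : ∀ {a b} → a ∨ b ≡ true → a ≡ true ⊎ b ≡ true
∨-true⁻¹ {true}  _  = inj₁ refl
∨-true⁻¹ {false} eq = inj₂ eq

<ᵇ-true : ∀ {a b} → a < b → (a <ᵇ b) ≡ true
<ᵇ-true = Equivalence.to T-≡ ∘ ℕP.<⇒<ᵇ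

<ᵇ-true⁻¹ : ∀ {a b} → (a <ᵇ b) ≡ true → a < b
<ᵇ-true⁻¹ {a} {b} = ℕP.<ᵇ⇒< a b ∘ Equivalence.from T-≡

<ᵇ-false : ∀ {a b} → b ≤ a → (a <ᵇ b) ≡ false
<ᵇ-false {a} {b} b≤a with a <ᵇ b in a<ᵇb
... | false = refl
... | true  = ⊥-elim (ℕP.<⇒≱ (<ᵇ-true⁻¹ {a} {b} a<ᵇb) b≤a)

countF-mono : ∀ {n} (f g : Fin n → Bool) → (∀ j → f j ≡ true → g j ≡ true) → countF f ≤ countF g
countF-mono {zero}  f g f⊆g = z≤n
countF-mono {suc n} f g f⊆g with f Fin.zero in f0 | g Fin.zero in g0
... | true  | true  = s≤s (countF-mono (f ∘ Fin.suc) (g ∘ Fin.suc) (f⊆g ∘ Fin.suc))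
... | false | true  = ℕP.m≤n⇒m≤1+n (countF-mono (f ∘ Fin.suc) (g ∘ Fin.suc) (f⊆g ∘ Fin.suc))
... | false | false = countF-mono (f ∘ Fin.suc) (g ∘ Fin.suc) (f⊆g ∘ Fin.suc)
... | true  | false with () ← trans (sym (f⊆g Fin.zero f0)) g0

<ᵇ-countF-antitone : ∀ {n} {f g : Fin n → Bool} {c} → (∀ j → f j ≡ true → g j ≡ true) →
  (countF g <ᵇ c) ≡ true → (countF f <ᵇ c) ≡ true
<ᵇ-countF-antitone {f = f} {g} {c} f⊆g lt = <ᵇ-true (ℕP.≤-<-trans (countF-mono f g f⊆g) (<ᵇ-true⁻¹ {countF g} {c} lt))

countF+countF-not : ∀ {n} (f : Fin n → Bool) → countF f + countF (not ∘ f) ≡ n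
countF+countF-not {zero}  f = refl
countF+countF-not {suc n} f with f Fin.zero
... | true  = cong suc (countF+countF-not (f ∘ Fin.suc))
... | false = trans (ℕP.+-suc (countF (f ∘ Fin.suc)) _) (cong suc (countF+countF-not (f ∘ Fin.suc)))

countℕ : ℕ → (ℕ → Bool) → ℕ
countℕ zero    g = 0
countℕ (suc n) g = (if g 0 then 1 else 0) + countℕ n (g ∘ suc)

countF-toℕ : ∀ {n} (g : ℕ → Bool) → countF {n} (g ∘ toℕ) ≡ countℕ n g
countF-toℕ {zero}  g = refl
countF-toℕ {suc n} g = cong (λ c → (if g 0 then 1 else 0) + c) (countF-toℕ {n} (g ∘ suc))

countℕ-+ : ∀ a b g → countℕ (a + b) g ≡ countℕ a g + countℕ b (λ t → g (a + t))
countℕ-+ zero    b g = refl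
countℕ-+ (suc a) b g = trans (cong (λ c → g₀ + c) (countℕ-+ a b (g ∘ suc))) (sym (ℕP.+-assoc g₀ _ _))
  where g₀ = if g 0 then 1 else 0

countℕ-all : ∀ n g → (∀ t → t < n → g t ≡ true) → countℕ n g ≡ n
countℕ-all zero    g all = refl
countℕ-all (suc n) g all rewrite all 0 (s≤s z≤n) =
  cong suc (countℕ-all n (g ∘ suc) (λ t t<n → all (suc t) (s≤s t<n)))

countℕ-none : ∀ n g → (∀ t → t < n → g t ≡ false) → countℕ n g ≡ 0
countℕ-none zero    g none = refl
countℕ-none (suc n) g none rewrite none 0 (s≤s z≤n) =
  countℕ-none n (g ∘ suc) (λ t t<n → none (suc t) (s≤s t<n))

countℕ-+₃ : ∀ a b c g →
  countℕ (a + b + c) g ≡ countℕ a g + countℕ b (λ t → g (a + t)) + countℕ c (λ t → g (a + b + t))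
countℕ-+₃ a b c g = trans (countℕ-+ (a + b) c g) (cong (_+ countℕ c (λ t → g (a + b + t))) (countℕ-+ a b g))

-- The positions t < n on the cyclic arc i+1, …, i+L (mod n).
onArc : (n i L : ℕ) → ℕ → Bool
onArc n i L t = (⌊ i <? t ⌋ ∧ ⌊ t ≤? i + L ⌋) ∨ ⌊ t + n ≤? i + L ⌋

module _ (n i L : ℕ) {t : ℕ} where

  onArc-direct : i < t → t ≤ i + L → onArc n i L t ≡ true
  onArc-direct i<t t≤i+L rewrite ⌊⌋-true (i <? t) i<t | ⌊⌋-true (t ≤? i + L) t≤i+L = refl

  onArc-wrapped : t + n ≤ i + L → onArc n i L t ≡ true
  onArc-wrapped t+n≤i+L rewrite ⌊⌋-true (t + n ≤? i + L) t+n≤i+L = ∨-zeroʳ _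

  onArc-off : (i < t → ¬ t ≤ i + L) → ¬ t + n ≤ i + L → onArc n i L t ≡ false
  onArc-off notDirect notWrapped rewrite ⌊⌋-false (t + n ≤? i + L) notWrapped with i <? t
  ... | no  _   = refl
  ... | yes i<t rewrite ⌊⌋-false (t ≤? i + L) (notDirect i<t) = refl

  onArc⁻¹ : onArc n i L t ≡ true → (i < t × t ≤ i + L) ⊎ t + n ≤ i + L
  onArc⁻¹ eq with i <? t | t ≤? i + L | t + n ≤? i + L
  ... | yes i<t | yes t≤i+L | _            = inj₁ (i<t , t≤i+L)
  ... | _       | _         | yes wrapped = inj₂ wrapped
  ... | no _    | _         | no _  with () ← eq
  ... | yes _   | no _      | no _  with () ← eq

module _ (n i L : ℕ) (i<n : i < n) where

  private
    arc = onArc n i L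

  countℕ-onArc-within : i + L < n → countℕ n arc ≡ L
  countℕ-onArc-within i+L<n = begin
    countℕ n arc
      ≡⟨ cong (λ m → countℕ m arc) (sym (ℕP.m+[n∸m]≡n i+L<n)) ⟩
    countℕ (suc i + L + rest) arc
      ≡⟨ countℕ-+₃ (suc i) L rest arc ⟩
    countℕ (suc i) arc + countℕ L (λ t → arc (suc i + t)) + countℕ rest (λ t → arc (suc i + L + t))
      ≡⟨ cong₂ _+_ (cong₂ _+_ before middle) after ⟩
    0 + L + 0
      ≡⟨ ℕP.+-identityʳ L ⟩
    L ∎
    where
    open ≡-Reasoning
    rest = n ∸ (suc i + L)
    noWrap : ∀ t → ¬ t + n ≤ i + L
    noWrap t h = ℕP.<⇒≱ i+L<n (ℕP.≤-trans (ℕP.m≤n+m n t) h)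
    before = countℕ-none (suc i) arc λ t t≤i →
      onArc-off n i L (λ i<t → ⊥-elim (ℕP.<⇒≱ i<t (ℕP.≤-pred t≤i))) (noWrap t)
    middle = countℕ-all L _ λ t t<L →
      onArc-direct n i L (s≤s (ℕP.m≤m+n i t)) (subst (_≤ i + L) (ℕP.+-suc i t) (ℕP.+-monoʳ-≤ i t<L))
    after = countℕ-none rest _ λ t _ →
      onArc-off n i L (λ _ → ℕP.<⇒≱ (s≤s (ℕP.m≤m+n (i + L) t))) (noWrap (suc i + L + t))

  countℕ-onArc-wrapping : L ≤ n → n ≤ i + L → countℕ n arc ≡ L
  countℕ-onArc-wrapping L≤n n≤i+L = begin
    countℕ n arc
      ≡⟨ cong (λ m → countℕ m arc) (sym split) ⟩
    countℕ (suc e + (i ∸ e) + (n ∸ suc i)) arc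
      ≡⟨ countℕ-+₃ (suc e) (i ∸ e) (n ∸ suc i) arc ⟩
    countℕ (suc e) arc + countℕ (i ∸ e) (λ t → arc (suc e + t))
      + countℕ (n ∸ suc i) (λ t → arc (suc e + (i ∸ e) + t))
      ≡⟨ cong₂ _+_ (cong₂ _+_ wrapped gap) direct ⟩
    suc e + 0 + (n ∸ suc i)
      ≡⟨ total ⟩
    L ∎
    where
    open ≡-Reasoning
    e = i + L ∸ n
    e+n : e + n ≡ i + L
    e+n = ℕP.m∸n+n≡m n≤i+L
    e≤i : e ≤ i
    e≤i = ℕP.+-cancelʳ-≤ n e i (subst (_≤ i + n) (sym e+n) (ℕP.+-monoʳ-≤ i L≤n))
    suc-e+[i∸e] : suc e + (i ∸ e) ≡ suc i
    suc-e+[i∸e] = cong suc (ℕP.m+[n∸m]≡n e≤i)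
    split : suc e + (i ∸ e) + (n ∸ suc i) ≡ n
    split = trans (cong (_+ (n ∸ suc i)) suc-e+[i∸e]) (ℕP.m+[n∸m]≡n i<n)
    wrapped = countℕ-all (suc e) arc λ t t≤e →
      onArc-wrapped n i L (subst (t + n ≤_) e+n (ℕP.+-monoˡ-≤ n (ℕP.≤-pred t≤e)))
    gap = countℕ-none (i ∸ e) _ λ t t<i∸e →
      onArc-off n i L
        (λ i<t _ → ℕP.<⇒≱ i<t
          (subst (suc e + t ≤_) (ℕP.m+[n∸m]≡n e≤i)
            (subst (_≤ e + (i ∸ e)) (ℕP.+-suc e t) (ℕP.+-monoʳ-≤ e t<i∸e))))
        (ℕP.<⇒≱ (subst (_< suc e + t + n) e+n (ℕP.+-monoˡ-< n (s≤s (ℕP.m≤m+n e t)))))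
    direct = countℕ-all (n ∸ suc i) _ λ t t<rest →
      subst (λ s → arc (s + t) ≡ true) (sym suc-e+[i∸e])
        (onArc-direct n i L (s≤s (ℕP.m≤m+n i t))
          (ℕP.<⇒≤ (ℕP.<-≤-trans
            (subst (suc i + t <_) (ℕP.m+[n∸m]≡n i<n) (ℕP.+-monoʳ-< (suc i) t<rest)) n≤i+L)))
    total : suc e + 0 + (n ∸ suc i) ≡ L
    total = ℕP.+-cancelʳ-≡ (suc i) _ _ (begin
      suc e + 0 + (n ∸ suc i) + suc i   ≡⟨ cong (λ s → s + (n ∸ suc i) + suc i) (ℕP.+-identityʳ (suc e)) ⟩
      suc e + (n ∸ suc i) + suc i       ≡⟨ ℕP.+-assoc (suc e) _ _ ⟩
      suc e + ((n ∸ suc i) + suc i)     ≡⟨ cong (λ c → suc e + c) (ℕP.m∸n+n≡m i<n) ⟩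
      suc (e + n)                       ≡⟨ cong suc (trans e+n (ℕP.+-comm i L)) ⟩
      suc (L + i)                       ≡⟨ sym (ℕP.+-suc L i) ⟩
      L + suc i                         ∎)

  countF-onArc : L ≤ n → countF {n} (onArc n i L ∘ toℕ) ≡ L
  countF-onArc L≤n with i + L <? n
  ... | yes within = trans (countF-toℕ {n} arc) (countℕ-onArc-within within)
  ... | no  wraps  = trans (countF-toℕ {n} arc) (countℕ-onArc-wrapping L≤n (ℕP.≮⇒≥ wraps))

∸-suc : ∀ {m n} → suc n ≤ m → m ∸ n ≡ suc (m ∸ suc n)
∸-suc {m} {n} = ℕP.+-∸-assoc 1 {m} {suc n}

≤⇒≡+ : ∀ {i j : ℤ} → i ℤ.≤ j → Σ ℕ λ d → j ≡ i ℤ.+ + d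
≤⇒≡+ {i} {j} i≤j = ∣ j ℤ.- i ∣ , (begin
  j                    ≡⟨ i+[j-i]≡j i j ⟨
  i ℤ.+ (j ℤ.- i)      ≡⟨ cong (λ c → i ℤ.+ c) (ℤP.0≤i⇒+∣i∣≡i (ℤP.i≤j⇒0≤j-i i≤j)) ⟨
  i ℤ.+ + ∣ j ℤ.- i ∣  ∎)
  where
  open ≡-Reasoning
  i+[j-i]≡j : ∀ i j → i ℤ.+ (j ℤ.- i) ≡ j
  i+[j-i]≡j = solve-∀

private
  -i+[i+j]≡j : ∀ i j → ℤ.- i ℤ.+ (i ℤ.+ j) ≡ j
  -i+[i+j]≡j = solve-∀

+-cancelˡ-≤ : ∀ i {j k} → i ℤ.+ j ℤ.≤ i ℤ.+ k → j ℤ.≤ k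
+-cancelˡ-≤ i {j} {k} le = subst₂ ℤ._≤_ (-i+[i+j]≡j i j) (-i+[i+j]≡j i k) (ℤP.+-monoʳ-≤ (ℤ.- i) le)

+-cancelˡ-< : ∀ i {j k} → i ℤ.+ j ℤ.< i ℤ.+ k → j ℤ.< k
+-cancelˡ-< i {j} {k} lt = subst₂ ℤ._<_ (-i+[i+j]≡j i j) (-i+[i+j]≡j i k) (ℤP.+-monoʳ-< (ℤ.- i) lt)

+-cancelʳ-≤ : ∀ {i j} k → i ℤ.+ k ℤ.≤ j ℤ.+ k → i ℤ.≤ j
+-cancelʳ-≤ {i} {j} k le = +-cancelˡ-≤ k (subst₂ ℤ._≤_ (ℤP.+-comm i k) (ℤP.+-comm j k) le)

+-cancelʳ-< : ∀ {i j} k → i ℤ.+ k ℤ.< j ℤ.+ k → i ℤ.< j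
+-cancelʳ-< {i} {j} k lt = +-cancelˡ-< k (subst₂ ℤ._<_ (ℤP.+-comm i k) (ℤP.+-comm j k) lt)

y+c+d≡x+c⇒x-y≡d : ∀ {x y d} c → y ℤ.+ c ℤ.+ d ≡ x ℤ.+ c → x ℤ.- y ≡ d
y+c+d≡x+c⇒x-y≡d {x} {y} {d} c eq = begin
  x ℤ.- y                        ≡⟨ lemma₁ x y c ⟩
  x ℤ.+ c ℤ.- (y ℤ.+ c)          ≡⟨ cong (ℤ._- (y ℤ.+ c)) eq ⟨
  y ℤ.+ c ℤ.+ d ℤ.- (y ℤ.+ c)    ≡⟨ lemma₂ y c d ⟩
  d                              ∎
  where
  open ≡-Reasoning
  lemma₁ : ∀ x y c → x ℤ.- y ≡ x ℤ.+ c ℤ.- (y ℤ.+ c)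
  lemma₁ = solve-∀
  lemma₂ : ∀ y c d → y ℤ.+ c ℤ.+ d ℤ.- (y ℤ.+ c) ≡ d
  lemma₂ = solve-∀

offset-≤⁻¹ : ∀ B {s t} → B ℤ.+ + s ℤ.≤ B ℤ.+ + t → s ≤ t
offset-≤⁻¹ B = ℤP.drop‿+≤+ ∘ +-cancelˡ-≤ B

offset-<⁻¹ : ∀ B {s t} → B ℤ.+ + s ℤ.< B ℤ.+ + t → s < t
offset-<⁻¹ B = ℤP.drop‿+<+ ∘ +-cancelˡ-< B

offset-pred : ∀ B s → B ℤ.+ + suc s ℤ.- 1ℤ ≡ B ℤ.+ + s
offset-pred B s = lemma B (+ s)
  where
  lemma : ∀ B t → B ℤ.+ (1ℤ ℤ.+ t) ℤ.- 1ℤ ≡ B ℤ.+ t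
  lemma = solve-∀

module _ {ℓ : ℕ} where

  isMult-true : ∀ {z} → + ℓ ∣ z → isMult ℓ z ≡ true
  isMult-true {z} ℓ∣z = ⌊⌋-true (ℓ ℕ∣.∣? ∣ z ∣) (ℤ∣.∣⇒∣ᵤ ℓ∣z)

  isMult-true⁻¹ : ∀ {z} → isMult ℓ z ≡ true → + ℓ ∣ z
  isMult-true⁻¹ {z} eq = ℤ∣.∣ᵤ⇒∣ (⌊⌋-true⁻¹ (ℓ ℕ∣.∣? ∣ z ∣) eq)

  isMult-+ˡ : ∀ {B} z → + ℓ ∣ B → isMult ℓ (B ℤ.+ z) ≡ isMult ℓ z
  isMult-+ˡ {B} z ℓ∣B = ⌊⌋-⇔ (mk⇔ (λ d → ℤ∣.∣⇒∣ᵤ (ℤ∣.∣m+n∣m⇒∣n (ℤ∣.∣ᵤ⇒∣ d) ℓ∣B))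
                                    (λ d → ℤ∣.∣⇒∣ᵤ (ℤ∣.∣m∣n⇒∣m+n ℓ∣B (ℤ∣.∣ᵤ⇒∣ d))))
                              (ℓ ℕ∣.∣? ∣ B ℤ.+ z ∣) (ℓ ℕ∣.∣? ∣ z ∣)

  isMult-+ʳ : ∀ z {B} → + ℓ ∣ B → isMult ℓ (z ℤ.+ B) ≡ isMult ℓ z
  isMult-+ʳ z {B} ℓ∣B = trans (cong (isMult ℓ) (ℤP.+-comm z B)) (isMult-+ˡ z ℓ∣B)

  isMult-offset : ∀ {B s} → + ℓ ∣ B → 0 < s → s < ℓ → isMult ℓ (B ℤ.+ + s) ≡ false
  isMult-offset {B} {s@(suc _)} ℓ∣B _ s<ℓ =
    trans (isMult-+ˡ (+ s) ℓ∣B) (⌊⌋-false (ℓ ℕ∣.∣? s) (ℕ∣.>⇒∤ s<ℓ))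

  multiples-≤-<⇒≡ : ∀ {a b} → + ℓ ∣ a → + ℓ ∣ b → a ℤ.≤ b → b ℤ.< a ℤ.+ + ℓ → a ≡ b
  multiples-≤-<⇒≡ {a} {b} ℓ∣a ℓ∣b a≤b b<a+ℓ with ≤⇒≡+ a≤b
  ... | zero  , b≡a+0 = sym (trans b≡a+0 (ℤP.+-identityʳ a))
  ... | suc s , b≡a+s with () ← trans (sym (isMult-true ℓ∣b)) (trans (cong (isMult ℓ) b≡a+s)
          (isMult-offset ℓ∣a (s≤s z≤n) (offset-<⁻¹ a (subst (ℤ._< a ℤ.+ + ℓ) b≡a+s b<a+ℓ))))

-- v t and w t stand for the extension of the t-th state at positions u and u - k,
-- so that w t + ℓ is its value at u + (n - k).

module Tracking (ℓ : ℕ) (1<ℓ : 1 < ℓ) (v w : ℕ → ℤ)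
  (v-nonmult : ∀ t → t < ℓ → isMult ℓ (v t) ≡ false → v (suc t) ≡ v t ℤ.- 1ℤ)
  (v-stay    : ∀ t → t < ℓ → isMult ℓ (v t) ≡ true → v t ℤ.< w t ℤ.+ + ℓ → v (suc t) ≡ v t)
  (v-drop    : ∀ t → t < ℓ → isMult ℓ (v t) ≡ true → v t ≡ w t ℤ.+ + ℓ → v (suc t) ≡ v t ℤ.- 1ℤ)
  (w-nonmult : ∀ t → t < ℓ → isMult ℓ (w t) ≡ false → w (suc t) ≡ w t ℤ.- 1ℤ)
  (w-step    : ∀ t → t < ℓ → w t ℤ.- 1ℤ ℤ.≤ w (suc t))
  where

  module FromBase (B : ℤ) (ℓ∣B : + ℓ ∣ B) (α β : ℕ) (α<ℓ : α < ℓ) (α≤β : α ≤ β) (β≤ℓ : β ≤ ℓ)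
    (v₀ : v 0 ≡ B ℤ.+ + (ℓ + α)) (w₀ : w 0 ≡ B ℤ.+ + β)
    where

    ℓ∣B+ℓ : + ℓ ∣ B ℤ.+ + ℓ
    ℓ∣B+ℓ = ℤ∣.∣m∣n⇒∣m+n ℓ∣B ℤ∣.∣-refl

    isMult-above-B+ℓ : ∀ {s} → 0 < s → s < ℓ → isMult ℓ (B ℤ.+ + (ℓ + s)) ≡ false
    isMult-above-B+ℓ {s} 0<s s<ℓ =
      subst (λ z → isMult ℓ z ≡ false) (ℤP.+-assoc B (+ ℓ) (+ s)) (isMult-offset ℓ∣B+ℓ 0<s s<ℓ)

    w-lower : ∀ t → t ≤ β → B ℤ.+ + (β ∸ t) ℤ.≤ w t
    w-lower zero    _    = ℤP.≤-reflexive (sym w₀)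
    w-lower (suc t) t<β = ℤP.≤-trans (begin
      B ℤ.+ + (β ∸ suc t)               ≡⟨ offset-pred B (β ∸ suc t) ⟨
      B ℤ.+ + suc (β ∸ suc t) ℤ.- 1ℤ    ≡⟨ cong (λ s → B ℤ.+ + s ℤ.- 1ℤ) (∸-suc t<β) ⟨
      B ℤ.+ + (β ∸ t) ℤ.- 1ℤ            ≤⟨ ℤP.+-monoˡ-≤ (ℤ.- 1ℤ) (w-lower t (ℕP.<⇒≤ t<β)) ⟩
      w t ℤ.- 1ℤ                        ∎) (w-step t (ℕP.<-≤-trans t<β β≤ℓ))
      where open ℤP.≤-Reasoning

    w-exact : β < ℓ → ∀ t → t ≤ β → w t ≡ B ℤ.+ + (β ∸ t)
    w-exact β<ℓ zero    _   = w₀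
    w-exact β<ℓ (suc t) t<β = begin
      w (suc t)                          ≡⟨ w-nonmult t (ℕP.<-trans t<β β<ℓ) nonmult ⟩
      w t ℤ.- 1ℤ                         ≡⟨ cong (ℤ._- 1ℤ) (trans wt (cong (λ s → B ℤ.+ + s) (∸-suc t<β))) ⟩
      B ℤ.+ + suc (β ∸ suc t) ℤ.- 1ℤ     ≡⟨ offset-pred B (β ∸ suc t) ⟩
      B ℤ.+ + (β ∸ suc t)                ∎
      where
      open ≡-Reasoning
      wt = w-exact β<ℓ t (ℕP.<⇒≤ t<β)
      nonmult : isMult ℓ (w t) ≡ false
      nonmult = subst (λ z → isMult ℓ z ≡ false) (sym wt)
        (isMult-offset ℓ∣B (ℕP.m<n⇒0<n∸m t<β) (ℕP.≤-<-trans (ℕP.m∸n≤m β t) β<ℓ))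

    v-before : ∀ t → t ≤ β → v t ≡ B ℤ.+ + (ℓ + (α ∸ t))
    v-before zero    _   = v₀
    v-before (suc t) t<β with α ∸ t in α∸t | v-before t (ℕP.<⇒≤ t<β)
    ... | zero  | vt = begin
      v (suc t)                 ≡⟨ v-stay t t<ℓ mult below-w+ℓ ⟩
      v t                       ≡⟨ vt ⟩
      B ℤ.+ + (ℓ + 0)           ≡⟨ cong (λ s → B ℤ.+ + (ℓ + s)) α∸[1+t]≡0 ⟨
      B ℤ.+ + (ℓ + (α ∸ suc t)) ∎
      where
      open ≡-Reasoning
      t<ℓ = ℕP.<-≤-trans t<β β≤ℓ
      α∸[1+t]≡0 : α ∸ suc t ≡ 0
      α∸[1+t]≡0 = ℕP.m≤n⇒m∸n≡0 (ℕP.m≤n⇒m≤1+n (ℕP.m∸n≡0⇒m≤n {α} {t} α∸t))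
      mult : isMult ℓ (v t) ≡ true
      mult = subst (λ z → isMult ℓ z ≡ true) (trans (cong (λ s → B ℤ.+ + s) (sym (ℕP.+-identityʳ ℓ))) (sym vt))
        (isMult-true ℓ∣B+ℓ)
      below-w+ℓ : v t ℤ.< w t ℤ.+ + ℓ
      below-w+ℓ = ℤP.<-≤-trans
        (subst (ℤ._< B ℤ.+ + ((β ∸ t) + ℓ)) (trans (cong (λ s → B ℤ.+ + s) (ℕP.+-comm 0 ℓ)) (sym vt))
          (ℤP.+-monoʳ-< B (ℤ.+<+ (ℕP.+-monoˡ-< ℓ (ℕP.m<n⇒0<n∸m t<β)))))
        (subst (ℤ._≤ w t ℤ.+ + ℓ) (ℤP.+-assoc B (+ (β ∸ t)) (+ ℓ)) (ℤP.+-monoˡ-≤ (+ ℓ) (w-lower t (ℕP.<⇒≤ t<β))))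
    ... | suc s | vt = begin
      v (suc t)                        ≡⟨ v-nonmult t t<ℓ nonmult ⟩
      v t ℤ.- 1ℤ                       ≡⟨ cong (λ z → z ℤ.- 1ℤ) vt ⟩
      B ℤ.+ + (ℓ + suc s) ℤ.- 1ℤ       ≡⟨ cong (λ z → B ℤ.+ + z ℤ.- 1ℤ) (ℕP.+-suc ℓ s) ⟩
      B ℤ.+ + suc (ℓ + s) ℤ.- 1ℤ       ≡⟨ offset-pred B (ℓ + s) ⟩
      B ℤ.+ + (ℓ + s)                  ≡⟨ cong (λ z → B ℤ.+ + (ℓ + z)) α∸[1+t]≡s ⟨
      B ℤ.+ + (ℓ + (α ∸ suc t))        ∎
      where
      open ≡-Reasoning
      t<ℓ = ℕP.<-≤-trans t<β β≤ℓ
      α∸[1+t]≡s : α ∸ suc t ≡ s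
      α∸[1+t]≡s = trans (sym (ℕP.pred[m∸n]≡m∸[1+n] α t)) (cong ℕ.pred α∸t)
      s<α : suc s ≤ α
      s<α = subst (_≤ α) α∸t (ℕP.m∸n≤m α t)
      nonmult : isMult ℓ (v t) ≡ false
      nonmult = subst (λ z → isMult ℓ z ≡ false) (sym vt) (isMult-above-B+ℓ (s≤s z≤n) (ℕP.≤-<-trans s<α α<ℓ))

    v-at-β : v β ≡ B ℤ.+ + ℓ
    v-at-β = trans (v-before β ℕP.≤-refl)
      (cong (λ s → B ℤ.+ + s) (trans (cong (λ s → ℓ + s) (ℕP.m≤n⇒m∸n≡0 α≤β)) (ℕP.+-identityʳ ℓ)))

    -- Once w has come down to B, v leaves the multiple B + ℓ and keeps falling.
    v-after : β < ℓ → ∀ d → β + d ≤ ℓ → v (β + d) ≡ B ℤ.+ + (ℓ ∸ d)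
    v-after β<ℓ zero    _       = trans (cong v (ℕP.+-identityʳ β)) v-at-β
    v-after β<ℓ (suc d) β+d<ℓ = begin
      v (β + suc d)                    ≡⟨ cong v (ℕP.+-suc β d) ⟩
      v (suc (β + d))                  ≡⟨ falls d t<ℓ vd ⟩
      v (β + d) ℤ.- 1ℤ                 ≡⟨ cong (ℤ._- 1ℤ) (trans vd (cong (λ s → B ℤ.+ + s) (∸-suc d<ℓ))) ⟩
      B ℤ.+ + suc (ℓ ∸ suc d) ℤ.- 1ℤ   ≡⟨ offset-pred B (ℓ ∸ suc d) ⟩
      B ℤ.+ + (ℓ ∸ suc d)              ∎
      where
      open ≡-Reasoning
      t<ℓ : β + d < ℓ
      t<ℓ = subst (_≤ ℓ) (ℕP.+-suc β d) β+d<ℓ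
      d<ℓ : suc d ≤ ℓ
      d<ℓ = ℕP.≤-trans (ℕP.m≤n+m (suc d) β) β+d<ℓ
      vd = v-after β<ℓ d (ℕP.<⇒≤ t<ℓ)
      falls : ∀ d → β + d < ℓ → v (β + d) ≡ B ℤ.+ + (ℓ ∸ d) → v (suc (β + d)) ≡ v (β + d) ℤ.- 1ℤ
      falls zero t<ℓ vd =
        v-drop (β + 0) t<ℓ (subst (λ z → isMult ℓ z ≡ true) (sym vd) (isMult-true ℓ∣B+ℓ)) (begin
          v (β + 0)                ≡⟨ vd ⟩
          B ℤ.+ + ℓ                ≡⟨ cong (ℤ._+ + ℓ) B+[β∸β]≡B ⟨
          B ℤ.+ + (β ∸ β) ℤ.+ + ℓ  ≡⟨ cong (ℤ._+ + ℓ) (trans (cong w (ℕP.+-identityʳ β)) (w-exact β<ℓ β ℕP.≤-refl)) ⟨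
          w (β + 0) ℤ.+ + ℓ        ∎)
        where
        B+[β∸β]≡B : B ℤ.+ + (β ∸ β) ≡ B
        B+[β∸β]≡B = trans (cong (λ s → B ℤ.+ + s) (ℕP.n∸n≡0 β)) (ℤP.+-identityʳ B)
      falls (suc d) t<ℓ vd =
        v-nonmult (β + suc d) t<ℓ (subst (λ z → isMult ℓ z ≡ false) (sym vd)
          (isMult-offset ℓ∣B (ℕP.m<n⇒0<n∸m d<ℓ′) (ℕP.∸-monoʳ-< {o = 0} (s≤s z≤n) (ℕP.<⇒≤ d<ℓ′))))
        where
        d<ℓ′ : suc d < ℓ
        d<ℓ′ = ℕP.≤-<-trans (ℕP.m≤n+m (suc d) β) t<ℓ

    v-after-ℓ-steps : v ℓ ≡ w 0
    v-after-ℓ-steps with ℕP.m≤n⇒m<n∨m≡n β≤ℓ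
    ... | inj₁ β<ℓ = begin
      v ℓ                      ≡⟨ cong v (ℕP.m+[n∸m]≡n β≤ℓ) ⟨
      v (β + (ℓ ∸ β))          ≡⟨ v-after β<ℓ (ℓ ∸ β) (ℕP.≤-reflexive (ℕP.m+[n∸m]≡n β≤ℓ)) ⟩
      B ℤ.+ + (ℓ ∸ (ℓ ∸ β))    ≡⟨ cong (λ s → B ℤ.+ + s) (ℕP.m∸[m∸n]≡n β≤ℓ) ⟩
      B ℤ.+ + β                ≡⟨ w₀ ⟨
      w 0                      ∎
      where open ≡-Reasoning
    ... | inj₂ refl = trans v-at-β (sym w₀)

  module _ (v₀≤w₀+ℓ : v 0 ℤ.≤ w 0 ℤ.+ + ℓ) where

    private
      fromMultipleBelow : (μ : ℤ) → + ℓ ∣ μ → (α : ℕ) → α < ℓ → v 0 ≡ μ ℤ.+ + α → w 0 ℤ.≤ μ →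
                          v ℓ ≡ w 0
      fromMultipleBelow μ ℓ∣μ α α<ℓ v₀≡μ+α w₀≤μ =
        FromBase.v-after-ℓ-steps B ℓ∣B α β α<ℓ α≤β β≤ℓ v₀≡B+[ℓ+α] w₀≡B+β
        where
        B = μ ℤ.- + ℓ
        ℓ∣B : + ℓ ∣ B
        ℓ∣B = ℤ∣.∣m∣n⇒∣m-n ℓ∣μ ℤ∣.∣-refl
        μ+α≡B+[ℓ+α] : ∀ μ a l → μ ℤ.+ a ≡ (μ ℤ.- l) ℤ.+ (l ℤ.+ a)
        μ+α≡B+[ℓ+α] = solve-∀
        μ≡B+ℓ : ∀ μ l → μ ≡ (μ ℤ.- l) ℤ.+ l
        μ≡B+ℓ = solve-∀
        B≤w₀ : B ℤ.≤ w 0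
        B≤w₀ = +-cancelʳ-≤ (+ ℓ) (subst (ℤ._≤ w 0 ℤ.+ + ℓ) (μ≡B+ℓ μ (+ ℓ))
          (ℤP.≤-trans (subst (μ ℤ.≤_) (sym v₀≡μ+α) (ℤP.i≤i+j μ (+ α))) v₀≤w₀+ℓ))
        β = proj₁ (≤⇒≡+ B≤w₀)
        w₀≡B+β = proj₂ (≤⇒≡+ B≤w₀)
        β≤ℓ : β ≤ ℓ
        β≤ℓ = offset-≤⁻¹ B (subst₂ ℤ._≤_ w₀≡B+β (μ≡B+ℓ μ (+ ℓ)) w₀≤μ)
        v₀≡B+[ℓ+α] : v 0 ≡ B ℤ.+ + (ℓ + α)
        v₀≡B+[ℓ+α] = trans v₀≡μ+α (μ+α≡B+[ℓ+α] μ (+ α) (+ ℓ))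
        α≤β : α ≤ β
        α≤β = ℕP.+-cancelˡ-≤ ℓ α β (subst (ℓ + α ≤_) (ℕP.+-comm β ℓ) (offset-≤⁻¹ B
          (subst₂ ℤ._≤_ v₀≡B+[ℓ+α] (trans (cong (ℤ._+ + ℓ) w₀≡B+β) (ℤP.+-assoc B (+ β) (+ ℓ))) v₀≤w₀+ℓ)))

    -- fromMultipleBelow needs v 0 - μ < ℓ: take μ = z, or μ = z + ℓ when v 0 = z + ℓ.
    v-after-ℓ-steps : (z : ℤ) → + ℓ ∣ z → w 0 ℤ.≤ z → z ℤ.≤ v 0 → v ℓ ≡ w 0
    v-after-ℓ-steps z ℓ∣z w₀≤z z≤v₀ with ≤⇒≡+ z≤v₀
    ... | d , v₀≡z+d with d <? ℓ
    ... | yes d<ℓ = fromMultipleBelow z ℓ∣z d d<ℓ v₀≡z+d w₀≤z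
    ... | no  d≮ℓ =
      fromMultipleBelow (z ℤ.+ + ℓ) (ℤ∣.∣m∣n⇒∣m+n ℓ∣z ℤ∣.∣-refl) 0 (ℕP.<-trans (s≤s z≤n) 1<ℓ)
        (trans v₀≡z+d (trans (cong (λ s → z ℤ.+ + s) d≡ℓ) (sym (ℤP.+-identityʳ _))))
        (ℤP.≤-trans w₀≤z (ℤP.i≤i+j z (+ ℓ)))
      where
      d≡ℓ : d ≡ ℓ
      d≡ℓ = ℕP.≤-antisym
        (offset-≤⁻¹ z (subst₂ ℤ._≤_ v₀≡z+d refl (ℤP.≤-trans v₀≤w₀+ℓ (ℤP.+-monoˡ-≤ (+ ℓ) w₀≤z))))
        (ℕP.≮⇒≥ d≮ℓ)

module Extension (n₀ ℓ : ℕ) where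

  n : ℕ
  n = suc n₀

  idx : ℕ → Fin n
  idx p = Fin.fromℕ< (m%n<n p n)

  ext : (Fin n → ℤ) → ℕ → ℤ
  ext x p = x (idx p) ℤ.+ + (ℓ * (p / n))

  toℕ-idx : ∀ p → toℕ (idx p) ≡ p % n
  toℕ-idx p = FinP.toℕ-fromℕ< (m%n<n p n)

  toℕ-idx-< : ∀ {p} → p < n → toℕ (idx p) ≡ p
  toℕ-idx-< {p} p<n = trans (toℕ-idx p) (m<n⇒m%n≡m p<n)

  idx-toℕ : ∀ j → idx (toℕ j) ≡ j
  idx-toℕ j = FinP.toℕ-injective (toℕ-idx-< (FinP.toℕ<n j))

  idx-% : ∀ p → idx (p % n) ≡ idx p
  idx-% p = FinP.toℕ-injective (trans (toℕ-idx-< (m%n<n p n)) (sym (toℕ-idx p)))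

  idx-+n : ∀ p → idx (p + n) ≡ idx p
  idx-+n p = FinP.toℕ-injective (trans (toℕ-idx (p + n)) (trans ([m+n]%n≡m%n p n) (sym (toℕ-idx p))))

  ext-< : ∀ x {p} → p < n → ext x p ≡ x (idx p)
  ext-< x {p} p<n = begin
    x (idx p) ℤ.+ + (ℓ * (p / n))  ≡⟨ cong (λ q → x (idx p) ℤ.+ + (ℓ * q)) (m<n⇒m/n≡0 p<n) ⟩
    x (idx p) ℤ.+ + (ℓ * 0)        ≡⟨ cong (λ q → x (idx p) ℤ.+ + q) (ℕP.*-zeroʳ ℓ) ⟩
    x (idx p) ℤ.+ + 0              ≡⟨ ℤP.+-identityʳ _ ⟩
    x (idx p)                      ∎
    where open ≡-Reasoning

  ext-toℕ : ∀ x j → ext x (toℕ j) ≡ x j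
  ext-toℕ x j = trans (ext-< x (FinP.toℕ<n j)) (cong x (idx-toℕ j))

  ext-+n : ∀ x p → ext x (p + n) ≡ ext x p ℤ.+ + ℓ
  ext-+n x p = begin
    x (idx (p + n)) ℤ.+ + (ℓ * ((p + n) / n))  ≡⟨ cong₂ (λ i q → x i ℤ.+ + (ℓ * q)) (idx-+n p) [p+n]/n≡1+p/n ⟩
    x (idx p) ℤ.+ + (ℓ * suc (p / n))         ≡⟨ cong (λ q → x (idx p) ℤ.+ + q) (trans (ℕP.*-suc ℓ (p / n)) (ℕP.+-comm ℓ _)) ⟩
    x (idx p) ℤ.+ (+ (ℓ * (p / n)) ℤ.+ + ℓ)   ≡⟨ ℤP.+-assoc (x (idx p)) _ _ ⟨
    ext x p ℤ.+ + ℓ                           ∎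
    where
    open ≡-Reasoning
    [p+n]/n≡1+p/n : (p + n) / n ≡ suc (p / n)
    [p+n]/n≡1+p/n = trans (m/n≡1+[m∸n]/n (ℕP.m≤n+m n p)) (cong (λ q → suc (q / n)) (ℕP.m+n∸n≡m p n))

  ext-toℕ-+n : ∀ x j → ext x (toℕ j + n) ≡ x j ℤ.+ + ℓ
  ext-toℕ-+n x j = trans (ext-+n x (toℕ j)) (cong (ℤ._+ + ℓ) (ext-toℕ x j))

  ext-+*n : ∀ x p q → ext x (p + q * n) ≡ ext x p ℤ.+ + (ℓ * q)
  ext-+*n x p zero = begin
    ext x (p + 0)        ≡⟨ cong (ext x) (ℕP.+-identityʳ p) ⟩
    ext x p              ≡⟨ ℤP.+-identityʳ _ ⟨
    ext x p ℤ.+ + 0      ≡⟨ cong (λ r → ext x p ℤ.+ + r) (ℕP.*-zeroʳ ℓ) ⟨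
    ext x p ℤ.+ + (ℓ * 0) ∎
    where open ≡-Reasoning
  ext-+*n x p (suc q) = begin
    ext x (p + (n + q * n))           ≡⟨ cong (ext x) (trans (cong (λ r → p + r) (ℕP.+-comm n (q * n))) (sym (ℕP.+-assoc p _ n))) ⟩
    ext x (p + q * n + n)             ≡⟨ ext-+n x (p + q * n) ⟩
    ext x (p + q * n) ℤ.+ + ℓ         ≡⟨ cong (ℤ._+ + ℓ) (ext-+*n x p q) ⟩
    ext x p ℤ.+ + (ℓ * q) ℤ.+ + ℓ     ≡⟨ ℤP.+-assoc (ext x p) _ _ ⟩
    ext x p ℤ.+ + (ℓ * q + ℓ)         ≡⟨ cong (λ r → ext x p ℤ.+ + r) (trans (ℕP.+-comm (ℓ * q) ℓ) (sym (ℕP.*-suc ℓ q))) ⟩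
    ext x p ℤ.+ + (ℓ * suc q)         ∎
    where open ≡-Reasoning

  ext-% : ∀ x p → ext x p ≡ ext x (p % n) ℤ.+ + (ℓ * (p / n))
  ext-% x p = trans (cong (ext x) (m≡m%n+[m/n]*n p n)) (ext-+*n x (p % n) (p / n))

  isMult-ext : ∀ x p → isMult ℓ (ext x p) ≡ isMult ℓ (x (idx p))
  isMult-ext x p = isMult-+ʳ (x (idx p)) (ℤ∣.∣ᵤ⇒∣ (ℕ∣.m∣m*n (p / n)))

  module _ (k : ℕ) (y : Fin n → ℤ) (p : ℕ) where

    private
      [a-1]+c≡[a+c]-1 : ∀ a c → a ℤ.- 1ℤ ℤ.+ c ≡ a ℤ.+ c ℤ.- 1ℤ
      [a-1]+c≡[a+c]-1 = solve-∀

    ext-gmMove-bear : isBear k ℓ y (idx p) ≡ true → ext (gmMove k ℓ y) p ≡ ext y p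
    ext-gmMove-bear bear rewrite bear = refl

    ext-gmMove-bull : isBear k ℓ y (idx p) ≡ false → ext (gmMove k ℓ y) p ≡ ext y p ℤ.- 1ℤ
    ext-gmMove-bull bull rewrite bull = [a-1]+c≡[a+c]-1 (y (idx p)) (+ (ℓ * (p / n)))

    ext-gmMove-≥ : ext y p ℤ.- 1ℤ ℤ.≤ ext (gmMove k ℓ y) p
    ext-gmMove-≥ with isBear k ℓ y (idx p)
    ... | true  = ℤP.i≤j⇒i-k≤j 1ℤ ℤP.≤-refl
    ... | false = ℤP.≤-reflexive (sym ([a-1]+c≡[a+c]-1 (y (idx p)) (+ (ℓ * (p / n)))))

  -- Sorted with range at most ℓ is exactly what makes the extension nondecreasing.
  module Monotone (x : Fin n → ℤ) (sorted : Sorted x) (narrow : range x ℤ.≤ + ℓ) where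

    ext-mono-suc : ∀ p → ext x p ℤ.≤ ext x (suc p)
    ext-mono-suc p with suc (p % n) <? n
    ... | yes r+1<n = subst₂ ℤ._≤_ (sym (ext-% x p)) (sym ext[1+p])
                        (ℤP.+-monoˡ-≤ (+ (ℓ * (p / n))) ext[r]≤ext[1+r])
      where
      r = p % n
      ext[1+p] : ext x (suc p) ≡ ext x (suc r) ℤ.+ + (ℓ * (p / n))
      ext[1+p] = trans (cong (λ q → ext x (suc q)) (m≡m%n+[m/n]*n p n)) (ext-+*n x (suc r) (p / n))
      ext[r]≤ext[1+r] : ext x r ℤ.≤ ext x (suc r)
      ext[r]≤ext[1+r] = subst₂ ℤ._≤_ (sym (ext-< x (m%n<n p n))) (sym (ext-< x r+1<n))
        (sorted _ _ (subst₂ _≤_ (sym (toℕ-idx-< (m%n<n p n))) (sym (toℕ-idx-< r+1<n)) (ℕP.n≤1+n r)))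
    ... | no r+1≮n = subst₂ ℤ._≤_ (sym (ext-% x p)) (sym ext[1+p]) (begin
      ext x r ℤ.+ + (ℓ * q)                   ≡⟨ cong (λ z → z ℤ.+ + (ℓ * q)) (trans (ext-< x (m%n<n p n)) (cong x idx[r]≡last)) ⟩
      x (Fin.fromℕ n₀) ℤ.+ + (ℓ * q)          ≤⟨ ℤP.+-monoˡ-≤ (+ (ℓ * q)) last≤first+ℓ ⟩
      x Fin.zero ℤ.+ + ℓ ℤ.+ + (ℓ * q)        ≡⟨ ℤP.+-assoc (x Fin.zero) (+ ℓ) _ ⟩
      x Fin.zero ℤ.+ + (ℓ + ℓ * q)            ≡⟨ cong (λ r → x Fin.zero ℤ.+ + r) (ℕP.*-suc ℓ q) ⟨
      x Fin.zero ℤ.+ + (ℓ * suc q)            ≡⟨ cong (λ z → z ℤ.+ + (ℓ * suc q)) (ext-< x (s≤s z≤n)) ⟨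
      ext x 0 ℤ.+ + (ℓ * suc q)               ∎)
      where
      open ℤP.≤-Reasoning
      r = p % n
      q = p / n
      r+1≡n : suc r ≡ n
      r+1≡n = ℕP.≤-antisym (m%n<n p n) (ℕP.≮⇒≥ r+1≮n)
      ext[1+p] : ext x (suc p) ≡ ext x 0 ℤ.+ + (ℓ * suc q)
      ext[1+p] = trans (cong (λ t → ext x (suc t)) (m≡m%n+[m/n]*n p n))
                   (trans (cong (λ t → ext x (t + q * n)) r+1≡n) (ext-+*n x 0 (suc q)))
      idx[r]≡last : idx r ≡ Fin.fromℕ n₀
      idx[r]≡last = FinP.toℕ-injective
        (trans (toℕ-idx-< (m%n<n p n)) (trans (cong ℕ.pred r+1≡n) (sym (FinP.toℕ-fromℕ n₀))))
      last≤first+ℓ : x (Fin.fromℕ n₀) ℤ.≤ x Fin.zero ℤ.+ + ℓ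
      last≤first+ℓ = subst₂ ℤ._≤_ (lemma (x (Fin.fromℕ n₀)) (x Fin.zero)) (ℤP.+-comm (+ ℓ) (x Fin.zero))
                       (ℤP.+-monoˡ-≤ (x Fin.zero) narrow)
        where
        lemma : ∀ a b → a ℤ.- b ℤ.+ b ≡ a
        lemma = solve-∀

    ext-mono : ∀ {p q} → p ≤ q → ext x p ℤ.≤ ext x q
    ext-mono {p} {q} p≤q = subst (λ t → ext x p ℤ.≤ ext x t) (ℕP.m+[n∸m]≡n p≤q) (go (q ∸ p))
      where
      go : ∀ d → ext x p ℤ.≤ ext x (p + d)
      go zero    = ℤP.≤-reflexive (cong (ext x) (sym (ℕP.+-identityʳ p)))
      go (suc d) = ℤP.≤-trans (go d)
        (subst (λ t → ext x (p + d) ℤ.≤ ext x t) (sym (ℕP.+-suc p d)) (ext-mono-suc (p + d)))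

    ext-<⁻¹ : ∀ {p q} → ext x p ℤ.< ext x q → p < q
    ext-<⁻¹ {p} {q} lt with q ≤? p
    ... | yes q≤p = ⊥-elim (ℤP.<⇒≱ lt (ext-mono q≤p))
    ... | no  q≰p = ℕP.≰⇒> q≰p

module _ {n} (k ℓ : ℕ) (x : Fin n → ℤ) where

  precedersInM : Fin n → Fin n → Bool
  precedersInM i j = inM ℓ x j ∧ precedes x j i

  largerOutsideM : Fin n → Fin n → Bool
  largerOutsideM i j = not (inM ℓ x j) ∧ ⌊ i FinP.<? j ⌋

  isBear-manyMults : (n ∸ k ℕ.≤ᵇ m ℓ x) ≡ true → ∀ i →
    isBear k ℓ x i ≡ (inM ℓ x i ∧ (countF (precedersInM i) <ᵇ n ∸ k))
  isBear-manyMults many i with n ∸ k ℕ.≤ᵇ m ℓ x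
  ... | true = refl

  isBear-rightward : ∀ {i j} → toℕ i < toℕ j → x i ≡ x j → isBear k ℓ x i ≡ true → isBear k ℓ x j ≡ true
  isBear-rightward {i} {j} i<j xi≡xj bear-i with n ∸ k ℕ.≤ᵇ m ℓ x
  ... | true = ∧-true j∈M (<ᵇ-countF-antitone {c = n ∸ k} fewerBefore-j (∧-true⁻¹ʳ {inM ℓ x i} bear-i))
    where
    j∈M : inM ℓ x j ≡ true
    j∈M = trans (cong (isMult ℓ) (sym xi≡xj)) (∧-true⁻¹ˡ bear-i)
    fewerBefore-j : ∀ j′ → precedersInM j j′ ≡ true → precedersInM i j′ ≡ true
    fewerBefore-j j′ h with ∨-true⁻¹ {⌊ x j′ ℤP.<? x j ⌋} (∧-true⁻¹ʳ {inM ℓ x j′} h)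
    ... | inj₁ xj′<xj = ∧-true (∧-true⁻¹ˡ h) (∨-trueˡ {b = ⌊ x j′ ℤ.≟ x i ⌋ ∧ ⌊ i FinP.<? j′ ⌋}
          (⌊⌋-true (x j′ ℤP.<? x i) (subst (x j′ ℤ.<_) (sym xi≡xj) (⌊⌋-true⁻¹ (x j′ ℤP.<? x j) xj′<xj))))
    ... | inj₂ tie = ∧-true (∧-true⁻¹ˡ h) (∨-trueʳ {⌊ x j′ ℤP.<? x i ⌋} (∧-true
          (⌊⌋-true (x j′ ℤ.≟ x i) (trans (⌊⌋-true⁻¹ (x j′ ℤ.≟ x j) (∧-true⁻¹ˡ tie)) (sym xi≡xj)))
          (⌊⌋-true (i FinP.<? j′)
            (ℕP.<-trans i<j (⌊⌋-true⁻¹ (j FinP.<? j′) (∧-true⁻¹ʳ {⌊ x j′ ℤ.≟ x j ⌋} tie))))))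
  ... | false with ∨-true⁻¹ {inM ℓ x i} bear-i
  ...   | inj₁ i∈M = ∨-trueˡ (trans (cong (isMult ℓ) (sym xi≡xj)) i∈M)
  ...   | inj₂ few-i = ∨-trueʳ {inM ℓ x j} (<ᵇ-countF-antitone {c = n ∸ k ∸ m ℓ x} fewerAfter-j few-i)
    where
    fewerAfter-j : ∀ j′ → largerOutsideM j j′ ≡ true → largerOutsideM i j′ ≡ true
    fewerAfter-j j′ h = ∧-true (∧-true⁻¹ˡ h)
      (⌊⌋-true (i FinP.<? j′) (ℕP.<-trans i<j (⌊⌋-true⁻¹ (j FinP.<? j′) (∧-true⁻¹ʳ {not (inM ℓ x j′)} h))))

  gmMove-≤ : ∀ i → gmMove k ℓ x i ℤ.≤ x i
  gmMove-≤ i with isBear k ℓ x i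
  ... | true  = ℤP.≤-refl
  ... | false = ℤP.i≤j⇒i-k≤j 1ℤ ℤP.≤-refl

  gmMove-≥ : ∀ i → x i ℤ.- 1ℤ ℤ.≤ gmMove k ℓ x i
  gmMove-≥ i with isBear k ℓ x i
  ... | true  = ℤP.i≤j⇒i-k≤j 1ℤ ℤP.≤-refl
  ... | false = ℤP.≤-refl

  gmMove-sorted : Sorted x → Sorted (gmMove k ℓ x)
  gmMove-sorted sorted i j i≤j with ℤP.<-cmp (x i) (x j)
  ... | tri< xi<xj _ _ = ℤP.≤-trans (gmMove-≤ i) (ℤP.≤-trans xi≤xj-1 (gmMove-≥ j))
    where
    xi≤xj-1 : x i ℤ.≤ x j ℤ.- 1ℤ
    xi≤xj-1 = subst (x i ℤ.≤_) (ℤP.+-comm ℤ.-1ℤ (x j)) (ℤP.i<j⇒i≤pred[j] xi<xj)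
  ... | tri> _ _ xi>xj = ⊥-elim (ℤP.<⇒≱ xi>xj (sorted i j i≤j))
  ... | tri≈ _ xi≡xj _ with ℕP.m≤n⇒m<n∨m≡n i≤j
  ...   | inj₂ i≡j rewrite FinP.toℕ-injective i≡j = ℤP.≤-refl
  ...   | inj₁ i<j with isBear k ℓ x i in bear-i
  ...     | false = ℤP.≤-trans (ℤP.≤-reflexive (cong (ℤ._- 1ℤ) xi≡xj)) (gmMove-≥ j)
  ...     | true rewrite isBear-rightward i<j xi≡xj bear-i = ℤP.≤-reflexive xi≡xj

module Stable (n₀ ℓ k : ℕ) (1<ℓ : 1 < ℓ) (k<n : k < suc n₀)
  (x : Fin (suc n₀) → ℤ) (sorted : Sorted x) (narrow : range x ℤ.≤ + ℓ) (manyMults : suc n₀ ∸ k ≤ m ℓ x)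
  where

  open Extension n₀ ℓ
  open Monotone x sorted narrow

  L : ℕ
  L = n ∸ k

  isBear≡ : ∀ i → isBear k ℓ x i ≡ (inM ℓ x i ∧ (countF (precedersInM k ℓ x i) <ᵇ L))
  isBear≡ = isBear-manyMults k ℓ x (Equivalence.to T-≡ (ℕP.≤⇒≤ᵇ manyMults))

  -- If the extension is flat on the next L positions, all of them hold multiples preceding i; if it
  -- rises, every multiple preceding i sits on the next L - 1 positions.
  module _ {i : ℕ} (i<n : i < n) (mult : isMult ℓ (ext x i) ≡ true) where

    private
      c = ext x i
      x[i]≡c : x (idx i) ≡ c
      x[i]≡c = sym (ext-< x i<n)
      i∈M : inM ℓ x (idx i) ≡ true
      i∈M = trans (cong (isMult ℓ) x[i]≡c) mult
      toℕ[i] : toℕ (idx i) ≡ i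
      toℕ[i] = toℕ-idx-< i<n
      i≤j+n : ∀ (j : Fin n) → i ≤ toℕ j + n
      i≤j+n j = ℕP.≤-trans (ℕP.<⇒≤ i<n) (ℕP.m≤n+m n (toℕ j))

    isBear-plateau-<n : ext x (i + L) ℤ.≤ c → isBear k ℓ x (idx i) ≡ false
    isBear-plateau-<n flat = trans (isBear≡ (idx i)) (cong₂ _∧_ i∈M (<ᵇ-false L≤count))
      where
      flat-on : ∀ {p} → i ≤ p → p ≤ i + L → ext x p ≡ c
      flat-on i≤p p≤i+L = ℤP.≤-antisym (ℤP.≤-trans (ext-mono p≤i+L) flat) (ext-mono i≤p)
      arc⊆preceders : ∀ j → onArc n i L (toℕ j) ≡ true → precedersInM k ℓ x (idx i) j ≡ true
      arc⊆preceders j on with onArc⁻¹ n i L on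
      ... | inj₁ (i<j , j≤i+L) = ∧-true (trans (cong (isMult ℓ) x[j]≡c) mult)
          (∨-trueʳ {⌊ x j ℤP.<? x (idx i) ⌋} (∧-true
            (⌊⌋-true (x j ℤ.≟ x (idx i)) (trans x[j]≡c (sym x[i]≡c)))
            (⌊⌋-true (idx i FinP.<? j) (subst (_< toℕ j) (sym toℕ[i]) i<j))))
        where
        x[j]≡c : x j ≡ c
        x[j]≡c = trans (sym (ext-toℕ x j)) (flat-on (ℕP.<⇒≤ i<j) j≤i+L)
      ... | inj₂ j+n≤i+L = ∧-true j∈M (∨-trueˡ (⌊⌋-true (x j ℤP.<? x (idx i)) x[j]<x[i]))
        where
        x[j]+ℓ≡c : x j ℤ.+ + ℓ ≡ c
        x[j]+ℓ≡c = trans (sym (ext-toℕ-+n x j)) (flat-on (i≤j+n j) j+n≤i+L)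
        j∈M : inM ℓ x j ≡ true
        j∈M = trans (sym (isMult-+ʳ (x j) ℤ∣.∣-refl)) (trans (cong (isMult ℓ) x[j]+ℓ≡c) mult)
        x[j]<x[i] : x j ℤ.< x (idx i)
        x[j]<x[i] = subst (x j ℤ.<_) (trans x[j]+ℓ≡c (sym x[i]≡c))
          (subst (ℤ._< x j ℤ.+ + ℓ) (ℤP.+-identityʳ (x j)) (ℤP.+-monoʳ-< (x j) (ℤ.+<+ (ℕP.<-trans (s≤s z≤n) 1<ℓ))))
      L≤count : L ≤ countF (precedersInM k ℓ x (idx i))
      L≤count = subst (_≤ countF (precedersInM k ℓ x (idx i))) (countF-onArc n i L i<n (ℕP.m∸n≤m n k))
        (countF-mono (onArc n i L ∘ toℕ) (precedersInM k ℓ x (idx i)) arc⊆preceders)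

    isBear-rise-<n : c ℤ.< ext x (i + L) → isBear k ℓ x (idx i) ≡ true
    isBear-rise-<n rise = trans (isBear≡ (idx i)) (cong₂ _∧_ i∈M (<ᵇ-true count<L))
      where
      L′ = L ∸ 1
      L≡1+L′ : L ≡ suc L′
      L≡1+L′ = sym (ℕP.suc-pred L ⦃ ℕ.>-nonZero (ℕP.m<n⇒0<n∸m k<n) ⦄)
      before-rise : ∀ {p} → ext x p ≡ c → p ≤ i + L′
      before-rise {p} ext[p]≡c = ℕP.≤-pred (subst (p <_) (trans (cong (λ q → i + q) L≡1+L′) (ℕP.+-suc i L′))
        (ext-<⁻¹ (subst (ℤ._< ext x (i + L)) (sym ext[p]≡c) rise)))
      preceders⊆arc : ∀ j → precedersInM k ℓ x (idx i) j ≡ true → onArc n i L′ (toℕ j) ≡ true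
      preceders⊆arc j h with ∨-true⁻¹ {⌊ x j ℤP.<? x (idx i) ⌋} (∧-true⁻¹ʳ {inM ℓ x j} h)
      ... | inj₁ x[j]<x[i] = onArc-wrapped n i L′ {toℕ j} (before-rise (trans (ext-toℕ-+n x j) (sym c≡x[j]+ℓ)))
        where
        -- x j + ℓ is a multiple in [c, c + ℓ), hence equal to c.
        c≡x[j]+ℓ : c ≡ x j ℤ.+ + ℓ
        c≡x[j]+ℓ = multiples-≤-<⇒≡ (isMult-true⁻¹ {ℓ} mult)
          (ℤ∣.∣m∣n⇒∣m+n (isMult-true⁻¹ {ℓ} {x j} (∧-true⁻¹ˡ h)) ℤ∣.∣-refl)
          (subst (c ℤ.≤_) (ext-toℕ-+n x j) (ext-mono (i≤j+n j)))
          (ℤP.+-monoˡ-< (+ ℓ) (subst (x j ℤ.<_) x[i]≡c (⌊⌋-true⁻¹ (x j ℤP.<? x (idx i)) x[j]<x[i])))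
      ... | inj₂ tie = onArc-direct n i L′ {toℕ j}
          (subst (_< toℕ j) toℕ[i] (⌊⌋-true⁻¹ (idx i FinP.<? j) (∧-true⁻¹ʳ {⌊ x j ℤ.≟ x (idx i) ⌋} tie)))
          (before-rise (trans (ext-toℕ x j) (trans (⌊⌋-true⁻¹ (x j ℤ.≟ x (idx i)) (∧-true⁻¹ˡ tie)) x[i]≡c)))
      count<L : countF (precedersInM k ℓ x (idx i)) < L
      count<L = subst (countF (precedersInM k ℓ x (idx i)) <_) (sym L≡1+L′) (s≤s
        (subst (countF (precedersInM k ℓ x (idx i)) ≤_)
          (countF-onArc n i L′ i<n (ℕP.≤-trans (ℕP.m∸n≤m L 1) (ℕP.m∸n≤m n k)))
          (countF-mono (precedersInM k ℓ x (idx i)) (onArc n i L′ ∘ toℕ) preceders⊆arc)))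

  isBear-ext-nonmult : ∀ p → isMult ℓ (ext x p) ≡ false → isBear k ℓ x (idx p) ≡ false
  isBear-ext-nonmult p nonmult = trans (isBear≡ (idx p)) (∧-false (trans (sym (isMult-ext x p)) nonmult))

  private
    ext-+L : ∀ p → ext x (p + L) ≡ ext x (p % n + L) ℤ.+ + (ℓ * (p / n))
    ext-+L p = trans (cong (λ t → ext x (t + L)) (m≡m%n+[m/n]*n p n)) (trans (cong (ext x) (begin
      p % n + p / n * n + L     ≡⟨ ℕP.+-assoc (p % n) _ L ⟩
      p % n + (p / n * n + L)   ≡⟨ cong (λ t → p % n + t) (ℕP.+-comm (p / n * n) L) ⟩
      p % n + (L + p / n * n)   ≡⟨ ℕP.+-assoc (p % n) L _ ⟨
      p % n + L + p / n * n     ∎)) (ext-+*n x (p % n + L) (p / n)))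
      where open ≡-Reasoning

    isMult-ext-% : ∀ p → isMult ℓ (ext x (p % n)) ≡ isMult ℓ (ext x p)
    isMult-ext-% p = trans (isMult-ext x (p % n)) (trans (cong (isMult ℓ ∘ x) (idx-% p)) (sym (isMult-ext x p)))

  isBear-ext-rise : ∀ p → isMult ℓ (ext x p) ≡ true → ext x p ℤ.< ext x (p + L) → isBear k ℓ x (idx p) ≡ true
  isBear-ext-rise p mult rise = subst (λ j → isBear k ℓ x j ≡ true) (idx-% p)
    (isBear-rise-<n (m%n<n p n) (trans (isMult-ext-% p) mult)
      (+-cancelʳ-< (+ (ℓ * (p / n))) (subst₂ ℤ._<_ (ext-% x p) (ext-+L p) rise)))

  isBear-ext-plateau : ∀ p → isMult ℓ (ext x p) ≡ true → ext x (p + L) ℤ.≤ ext x p → isBear k ℓ x (idx p) ≡ false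
  isBear-ext-plateau p mult flat = subst (λ j → isBear k ℓ x j ≡ false) (idx-% p)
    (isBear-plateau-<n (m%n<n p n) (trans (isMult-ext-% p) mult)
      (+-cancelʳ-≤ (+ (ℓ * (p / n))) (subst₂ ℤ._≤_ (ext-+L p) (ext-% x p) flat)))

  -- k + 1 consecutive positions without a multiple would give at least k + 1 entries outside M.
  multiple-free-window-impossible : ∀ q → 0 < q → ¬ (∀ s → s ≤ k → isMult ℓ (ext x (q + s)) ≡ false)
  multiple-free-window-impossible (suc q′) _ free = ℕP.<⇒≱ m<L manyMults
    where
    i = q′ % n
    R = q′ / n
    i<n = m%n<n q′ n
    free′ : ∀ s → s ≤ k → isMult ℓ (ext x (suc i + s)) ≡ false
    free′ s s≤k = begin
      isMult ℓ (ext x (suc i + s))                   ≡⟨ isMult-+ʳ (ext x (suc i + s)) (ℤ∣.∣ᵤ⇒∣ (ℕ∣.m∣m*n R)) ⟨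
      isMult ℓ (ext x (suc i + s) ℤ.+ + (ℓ * R))      ≡⟨ cong (isMult ℓ) (ext-+*n x (suc i + s) R) ⟨
      isMult ℓ (ext x (suc i + s + R * n))            ≡⟨ cong (isMult ℓ ∘ ext x) (ℕP.+-comm (suc i + s) (R * n)) ⟩
      isMult ℓ (ext x (R * n + (suc i + s)))          ≡⟨ cong (isMult ℓ ∘ ext x) (ℕP.+-assoc (R * n) (suc i) s) ⟨
      isMult ℓ (ext x (R * n + suc i + s))            ≡⟨ cong (λ t → isMult ℓ (ext x (t + s))) q≡ ⟩
      isMult ℓ (ext x (suc q′ + s))                   ≡⟨ free s s≤k ⟩
      false                                           ∎
      where
      open ≡-Reasoning
      q≡ : R * n + suc i ≡ suc q′
      q≡ = trans (ℕP.+-suc (R * n) i) (cong suc (trans (ℕP.+-comm (R * n) i) (sym (m≡m%n+[m/n]*n q′ n))))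
    offset≤k : ∀ {p} → p ≤ i + suc k → p ∸ suc i ≤ k
    offset≤k {p} p≤ = subst (p ∸ suc i ≤_) (trans (cong (_∸ suc i) (ℕP.+-suc i k)) (ℕP.m+n∸m≡n i k))
      (ℕP.∸-monoˡ-≤ (suc i) p≤)
    arc⊆outsideM : ∀ j → onArc n i (suc k) (toℕ j) ≡ true → not (inM ℓ x j) ≡ true
    arc⊆outsideM j on with onArc⁻¹ n i (suc k) {toℕ j} on
    ... | inj₁ (i<j , j≤) = cong not (begin
      isMult ℓ (x j)                       ≡⟨ cong (isMult ℓ) (ext-toℕ x j) ⟨
      isMult ℓ (ext x (toℕ j))             ≡⟨ cong (isMult ℓ ∘ ext x) (ℕP.m+[n∸m]≡n i<j) ⟨
      isMult ℓ (ext x (suc i + (toℕ j ∸ suc i))) ≡⟨ free′ _ (offset≤k j≤) ⟩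
      false                                ∎)
      where open ≡-Reasoning
    ... | inj₂ j+n≤ = cong not (begin
      isMult ℓ (x j)                       ≡⟨ isMult-+ʳ (x j) {+ ℓ} ℤ∣.∣-refl ⟨
      isMult ℓ (x j ℤ.+ + ℓ)               ≡⟨ cong (isMult ℓ) (ext-toℕ-+n x j) ⟨
      isMult ℓ (ext x (toℕ j + n))         ≡⟨ cong (isMult ℓ ∘ ext x) (ℕP.m+[n∸m]≡n i<j+n) ⟨
      isMult ℓ (ext x (suc i + (toℕ j + n ∸ suc i))) ≡⟨ free′ _ (offset≤k j+n≤) ⟩
      false                                ∎)
      where
      open ≡-Reasoning
      i<j+n : suc i ≤ toℕ j + n
      i<j+n = ℕP.≤-trans i<n (ℕP.m≤n+m n (toℕ j))
    k<outside : suc k ≤ countF (not ∘ inM ℓ x)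
    k<outside = subst (_≤ countF (not ∘ inM ℓ x)) (countF-onArc n i (suc k) i<n k<n)
      (countF-mono (onArc n i (suc k) ∘ toℕ) (not ∘ inM ℓ x) arc⊆outsideM)
    m<L : m ℓ x < L
    m<L = ℕP.+-cancelʳ-< k (m ℓ x) L
      (subst (m ℓ x + k <_) (trans (countF+countF-not (inM ℓ x)) (sym (ℕP.m∸n+n≡m (ℕP.<⇒≤ k<n))))
        (ℕP.+-monoʳ-< (m ℓ x) k<outside))

  multiple-in-window : ∀ q → 0 < q → Σ ℕ λ s → s ≤ k × isMult ℓ (ext x (q + s)) ≡ true
  multiple-in-window q 0<q with FinP.any? (λ (s : Fin (suc k)) → isMult ℓ (ext x (q + toℕ s)) ≟ true)
  ... | yes (s , mult) = toℕ s , ℕP.≤-pred (FinP.toℕ<n s) , mult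
  ... | no none = ⊥-elim (multiple-free-window-impossible q 0<q λ s s≤k → ≢true⇒≡false λ mult →
    none (Fin.fromℕ< (s≤s s≤k) ,
          subst (λ t → isMult ℓ (ext x (q + t)) ≡ true) (sym (FinP.toℕ-fromℕ< (s≤s s≤k))) mult))

module Rotation (n₀ k ℓ : ℕ) (1<ℓ : 1 < ℓ) (k<n : k < suc n₀)
  (x₀ : Fin (suc n₀) → ℤ) (sorted₀ : Sorted x₀) (N : ℕ)
  (stable : ∀ j → N ≤ j → (suc n₀ ∸ k ≤ m ℓ (gmSeq k ℓ x₀ j)) × (range (gmSeq k ℓ x₀ j) ℤ.≤ + ℓ))
  where

  open Extension n₀ ℓ

  X : ℕ → Fin n → ℤ
  X = gmSeq k ℓ x₀

  X-sorted : ∀ j → Sorted (X j)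
  X-sorted zero    = sorted₀
  X-sorted (suc j) = gmMove-sorted k ℓ (X j) (X-sorted j)

  ext-rotate : ∀ t → N ≤ t → ∀ u → k < u → ext (X (t + ℓ)) u ≡ ext (X t) (u ∸ k)
  ext-rotate t N≤t u k<u =
    trans (Tracking.v-after-ℓ-steps ℓ 1<ℓ v w v-nonmult v-stay v-drop w-nonmult w-step v₀≤w₀+ℓ
             z (isMult-true⁻¹ {ℓ} (proj₂ (proj₂ window))) w₀≤z z≤v₀)
          (cong (λ j → ext (X j) (u ∸ k)) (ℕP.+-identityʳ t))
    where
    Y : ℕ → Fin n → ℤ
    Y s = X (t + s)
    N≤t+s : ∀ s → N ≤ t + s
    N≤t+s s = ℕP.≤-trans N≤t (ℕP.m≤m+n t s)
    module S (s : ℕ) = Stable n₀ ℓ k 1<ℓ k<n (Y s) (X-sorted (t + s))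
      (proj₂ (stable (t + s) (N≤t+s s))) (proj₁ (stable (t + s) (N≤t+s s)))
    Y-suc : ∀ s → Y (suc s) ≡ gmMove k ℓ (Y s)
    Y-suc s = cong X (ℕP.+-suc t s)
    k≤u : k ≤ u
    k≤u = ℕP.<⇒≤ k<u
    v w : ℕ → ℤ
    v s = ext (Y s) u
    w s = ext (Y s) (u ∸ k)
    w+ℓ : ∀ s → w s ℤ.+ + ℓ ≡ ext (Y s) (u + S.L s)
    w+ℓ s = trans (sym (ext-+n (Y s) (u ∸ k))) (cong (ext (Y s)) (begin
      u ∸ k + n              ≡⟨ cong (λ r → u ∸ k + r) (ℕP.m+[n∸m]≡n (ℕP.<⇒≤ k<n)) ⟨
      u ∸ k + (k + (n ∸ k))  ≡⟨ ℕP.+-assoc (u ∸ k) k _ ⟨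
      u ∸ k + k + (n ∸ k)    ≡⟨ cong (_+ (n ∸ k)) (ℕP.m∸n+n≡m k≤u) ⟩
      u + (n ∸ k)            ∎))
      where open ≡-Reasoning
    v-nonmult : ∀ s → s < ℓ → isMult ℓ (v s) ≡ false → v (suc s) ≡ v s ℤ.- 1ℤ
    v-nonmult s _ nonmult = trans (cong (λ y → ext y u) (Y-suc s))
      (ext-gmMove-bull k (Y s) u (S.isBear-ext-nonmult s u nonmult))
    v-stay : ∀ s → s < ℓ → isMult ℓ (v s) ≡ true → v s ℤ.< w s ℤ.+ + ℓ → v (suc s) ≡ v s
    v-stay s _ mult rise = trans (cong (λ y → ext y u) (Y-suc s))
      (ext-gmMove-bear k (Y s) u (S.isBear-ext-rise s u mult (subst (v s ℤ.<_) (w+ℓ s) rise)))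
    v-drop : ∀ s → s < ℓ → isMult ℓ (v s) ≡ true → v s ≡ w s ℤ.+ + ℓ → v (suc s) ≡ v s ℤ.- 1ℤ
    v-drop s _ mult flat = trans (cong (λ y → ext y u) (Y-suc s))
      (ext-gmMove-bull k (Y s) u (S.isBear-ext-plateau s u mult (ℤP.≤-reflexive (sym (trans flat (w+ℓ s))))))
    w-nonmult : ∀ s → s < ℓ → isMult ℓ (w s) ≡ false → w (suc s) ≡ w s ℤ.- 1ℤ
    w-nonmult s _ nonmult = trans (cong (λ y → ext y (u ∸ k)) (Y-suc s))
      (ext-gmMove-bull k (Y s) (u ∸ k) (S.isBear-ext-nonmult s (u ∸ k) nonmult))
    w-step : ∀ s → s < ℓ → w s ℤ.- 1ℤ ℤ.≤ w (suc s)
    w-step s _ = subst (λ y → w s ℤ.- 1ℤ ℤ.≤ ext y (u ∸ k)) (sym (Y-suc s)) (ext-gmMove-≥ k (Y s) (u ∸ k))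
    open Monotone (Y 0) (X-sorted (t + 0)) (proj₂ (stable (t + 0) (N≤t+s 0))) using (ext-mono)
    v₀≤w₀+ℓ : v 0 ℤ.≤ w 0 ℤ.+ + ℓ
    v₀≤w₀+ℓ = subst (v 0 ℤ.≤_) (sym (w+ℓ 0)) (ext-mono (ℕP.m≤m+n u (S.L 0)))
    window = S.multiple-in-window 0 (u ∸ k) (ℕP.m<n⇒0<n∸m k<u)
    z = ext (Y 0) (u ∸ k + proj₁ window)
    w₀≤z : w 0 ℤ.≤ z
    w₀≤z = ext-mono (ℕP.m≤m+n (u ∸ k) (proj₁ window))
    z≤v₀ : z ℤ.≤ v 0
    z≤v₀ = ext-mono (subst (u ∸ k + proj₁ window ≤_) (ℕP.m∸n+n≡m k≤u)
      (ℕP.+-monoʳ-≤ (u ∸ k) (proj₁ (proj₂ window))))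

  ext-rotate-iter : ∀ a t → N ≤ t → ∀ u → a * k < u → ext (X (t + a * ℓ)) u ≡ ext (X t) (u ∸ a * k)
  ext-rotate-iter zero    t N≤t u _ = cong (λ j → ext (X j) u) (ℕP.+-identityʳ t)
  ext-rotate-iter (suc a) t N≤t u k+ak<u = begin
    ext (X (t + (ℓ + a * ℓ))) u     ≡⟨ cong (λ r → ext (X (t + r)) u) (ℕP.+-comm ℓ (a * ℓ)) ⟩
    ext (X (t + (a * ℓ + ℓ))) u     ≡⟨ cong (λ j → ext (X j) u) (ℕP.+-assoc t (a * ℓ) ℓ) ⟨
    ext (X (t + a * ℓ + ℓ)) u       ≡⟨ ext-rotate (t + a * ℓ) (ℕP.≤-trans N≤t (ℕP.m≤m+n t _)) u k<u ⟩
    ext (X (t + a * ℓ)) (u ∸ k)     ≡⟨ ext-rotate-iter a t N≤t (u ∸ k) ak<u∸k ⟩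
    ext (X t) (u ∸ k ∸ a * k)       ≡⟨ cong (ext (X t)) (ℕP.∸-+-assoc u k (a * k)) ⟩
    ext (X t) (u ∸ (k + a * k))     ∎
    where
    open ≡-Reasoning
    k<u : k < u
    k<u = ℕP.≤-<-trans (ℕP.m≤m+n k (a * k)) k+ak<u
    ak<u∸k : a * k < u ∸ k
    ak<u∸k = ℕP.m+n≤o⇒m≤o∸n (suc (a * k)) (subst (λ r → suc r ≤ u) (ℕP.+-comm k (a * k)) k+ak<u)

  X-periodic : ∀ {a b} → a * k ≡ b * n → ∀ t → N ≤ t → ∀ i → X t i ℤ.- X (t + a * ℓ) i ≡ + (ℓ * b)
  X-periodic {a} {b} ak≡bn t N≤t i = y+c+d≡x+c⇒x-y≡d {X t i} {X (t + a * ℓ) i} (+ ℓ) (begin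
    X (t + a * ℓ) i ℤ.+ + ℓ ℤ.+ + (ℓ * b)       ≡⟨ cong (ℤ._+ + (ℓ * b)) (ext-toℕ-+n (X (t + a * ℓ)) i) ⟨
    ext (X (t + a * ℓ)) (toℕ i + n) ℤ.+ + (ℓ * b) ≡⟨ ext-+*n (X (t + a * ℓ)) (toℕ i + n) b ⟨
    ext (X (t + a * ℓ)) (toℕ i + n + b * n)     ≡⟨ ext-rotate-iter a t N≤t _ ak<u ⟩
    ext (X t) (toℕ i + n + b * n ∸ a * k)       ≡⟨ cong (λ r → ext (X t) (toℕ i + n + b * n ∸ r)) ak≡bn ⟩
    ext (X t) (toℕ i + n + b * n ∸ b * n)       ≡⟨ cong (ext (X t)) (ℕP.m+n∸n≡m (toℕ i + n) (b * n)) ⟩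
    ext (X t) (toℕ i + n)                       ≡⟨ ext-toℕ-+n (X t) i ⟩
    X t i ℤ.+ + ℓ                               ∎)
    where
    open ≡-Reasoning
    ak<u : a * k < toℕ i + n + b * n
    ak<u = subst (_< toℕ i + n + b * n) (sym ak≡bn)
      (ℕP.+-monoˡ-< (b * n) (ℕP.<-≤-trans (s≤s z≤n) (ℕP.m≤n+m n (toℕ i))))

-- With g = gcd n k: p = (n / g) ℓ, δ = ℓ (k / g), and (n / g) k = (k / g) n.
period-shift : ∀ n₀ k ℓ → Σ ℕ λ a → Σ ℕ λ b →
  period (suc n₀) k ℓ ≡ a * ℓ × shift (suc n₀) k ℓ ≡ ℓ * b × a * k ≡ b * suc n₀
period-shift n₀ k ℓ with gcd (suc n₀) k | gcd[m,n]∣m (suc n₀) k | gcd[m,n]∣n (suc n₀) k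
... | zero  | g∣n | _ with () ← ℕ∣.0∣⇒≡0 g∣n
... | suc g | g∣n | g∣k = a , b , p≡aℓ , δ≡ℓb , ak≡bn
  where
  n = suc n₀
  a = n / suc g
  b = k / suc g
  p≡aℓ : ℓ * n / suc g ≡ a * ℓ
  p≡aℓ = trans (*-/-assoc ℓ g∣n) (ℕP.*-comm ℓ a)
  swap : ∀ a b c → a * (b * c) ≡ b * (a * c)
  swap = ℕ-Ring.solve-∀
  ak≡bn : a * k ≡ b * n
  ak≡bn = trans (cong (a *_) (sym (m/n*n≡m g∣k))) (trans (swap a b (suc g)) (cong (b *_) (m/n*n≡m g∣n)))
  δ≡ℓb : ℓ * n / suc g * k / n ≡ ℓ * b
  δ≡ℓb = begin
    ℓ * n / suc g * k / n  ≡⟨ cong (λ p → p * k / n) p≡aℓ ⟩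
    a * ℓ * k / n          ≡⟨ cong (_/ n) (lemma a ℓ k) ⟩
    ℓ * (a * k) / n        ≡⟨ cong (λ r → ℓ * r / n) ak≡bn ⟩
    ℓ * (b * n) / n        ≡⟨ cong (_/ n) (sym (ℕP.*-assoc ℓ b n)) ⟩
    ℓ * b * n / n          ≡⟨ m*n/n≡m (ℓ * b) n ⟩
    ℓ * b                  ∎
    where
    open ≡-Reasoning
    lemma : ∀ a l k → a * l * k ≡ l * (a * k)
    lemma = ℕ-Ring.solve-∀

theorem1 : (n k ℓ : ℕ) → 0 < k → k < n → 1 < ℓ →
    (x0 : Fin n → ℤ) → Sorted x0 →
    (N : ℕ) →
    (∀ j → ((n ∸ k ≤ m ℓ (gmSeq k ℓ x0 j)) × (range (gmSeq k ℓ x0 j) ℤ.≤ + ℓ)) ⇔ (N ≤ j)) →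
    ∀ (i : Fin n) (j : ℕ) → N ≤ j →
    gmSeq k ℓ x0 j i ℤ.- gmSeq k ℓ x0 (j + period n k ℓ) i ≡ + shift n k ℓ
theorem1 zero     k ℓ _ () _ _ _ _ _ _ _ _
theorem1 (suc n₀) k ℓ _ k<n 1<ℓ x0 sorted N stable i j N≤j with period-shift n₀ k ℓ
... | a , b , p≡aℓ , δ≡ℓb , ak≡bn rewrite p≡aℓ | δ≡ℓb =
  Rotation.X-periodic n₀ k ℓ 1<ℓ k<n x0 sorted N (λ t → Equivalence.from (stable t)) {a} {b} ak≡bn j N≤j i
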